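{- Let $\Gamma$ be a connected finite simple graph with minimum vertex degree at least $2$ and first Betti number $b_1\geq 2$. Then $\ker(\phi^1_\Gamma)$ is trivial, i.e. $\mathcal{H}^1(\Gamma)\cong\mathrm{Aut}(\Gamma)$.
   Context: $b_1$ is the number of independent cycles of $\Gamma$. $\Omega^1(\Gamma)$ is the real vector space of functions $f$ on ordered pairs $(v,w)$ of adjacent vertices with $f(v,w)=-f(w,v)$; the coboundary $D$ maps a vertex function $u$ to $Du(v,w)=u(w)-u(v)$; $H^1(\Gamma)=\Omega^1(\Gamma)/\mathrm{Im}(D)$. Each $g\in\mathrm{Aut}(\Gamma)$ acts by pullback $g^*f(v,w)=f(g(v),g(w))$, which descends to $H^1(\Gamma)$. $\phi^1_\Gamma:\mathrm{Aut}(\Gamma)\to GL(H^1(\Gamma))$ is the homomorphism $\phi^1_\Gamma(g)=(g^*)^{ -1}$ and $\mathcal{H}^1(\Gamma)$ is its image.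
   Formalization: The spaces $\Omega^1(\Gamma)$ and $H^1(\Gamma)$, and the vertex functions in the image of $D$, are taken with rational coefficients instead of real ones. -}

module Defs where

open import Data.Nat using (ℕ; zero; suc; _+_; _∸_; _≤_; _<ᵇ_)
open import Data.Bool using (Bool; true; false; if_then_else_; _∧_)
open import Data.Fin using (Fin; zero; suc; toℕ)
open import Data.Fin.Permutation using (Permutation′; _⟨$⟩ʳ_)
open import Data.Rational using (ℚ; _-_; -_)
open import Data.Product using (Σ; ∃; _×_)
open import Relation.Binary.PropositionalEquality using (_≡_)

sumFin : ∀ {n} → (Fin n → ℕ) → ℕ
sumFin {zero}  f = 0
sumFin {suc n} f = f zero + sumFin (λ i → f (suc i))

record SimpleGraph (n : ℕ) : Set where
  field
    Adj   : Fin n → Fin n → Bool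
    sym   : ∀ v w → Adj v w ≡ Adj w v
    irrefl : ∀ v → Adj v v ≡ false
open SimpleGraph public

degree : ∀ {n} → SimpleGraph n → Fin n → ℕ
degree G v = sumFin (λ w → if Adj G v w then 1 else 0)

numEdges : ∀ {n} → SimpleGraph n → ℕ
numEdges {n} G = sumFin (λ v → sumFin (λ w → if (toℕ v <ᵇ toℕ w) ∧ Adj G v w then 1 else 0))

data Walk {n} (G : SimpleGraph n) : Fin n → Fin n → Set where
  here : ∀ {v} → Walk G v v
  step : ∀ {v u w} → Adj G v u ≡ true → Walk G u w → Walk G v w

Connected : ∀ {n} → SimpleGraph n → Set
Connected G = ∀ v w → Walk G v w

-- first Betti number (cyclomatic number) of a connected graph: |E| - |V| + 1
betti1 : ∀ {n} → SimpleGraph n → ℕ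
betti1 {n} G = (numEdges G + 1) ∸ n

record Aut {n} (G : SimpleGraph n) : Set where
  field
    perm : Permutation′ n
    preserves : ∀ v w → Adj G (perm ⟨$⟩ʳ v) (perm ⟨$⟩ʳ w) ≡ Adj G v w
open Aut public

-- Ω¹(Γ) with ℚ coefficients: functions on ordered adjacent pairs, antisymmetric.
-- (Values on non-adjacent pairs are irrelevant and ignored everywhere.)
record Ω¹ {n} (G : SimpleGraph n) : Set where
  field
    val : Fin n → Fin n → ℚ
    antisym : ∀ v w → Adj G v w ≡ true → val v w ≡ - val w v
open Ω¹ public

D : ∀ {n} → (Fin n → ℚ) → Fin n → Fin n → ℚ
D u v w = u w - u v

_≈H¹_ : ∀ {n} {G : SimpleGraph n} → Ω¹ G → Ω¹ G → Set
_≈H¹_ {n} {G} f f' = ∃ λ (u : Fin n → ℚ) →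
  ∀ v w → Adj G v w ≡ true → val f v w - val f' v w ≡ D u v w

pullback : ∀ {n} {G : SimpleGraph n} → Aut G → Ω¹ G → Ω¹ G
pullback {n} {G} g f = record
  { val = λ v w → val f (perm g ⟨$⟩ʳ v) (perm g ⟨$⟩ʳ w)
  ; antisym = λ v w a → antisym f _ _ (trans' (preserves g v w) a) }
  where
    trans' : ∀ {x y z : Bool} → x ≡ y → y ≡ z → x ≡ z
    trans' _≡_.refl q = q

-- g lies in ker φ¹_Γ  iff  (g*)⁻¹ = id on H¹  iff  g* acts as identity on H¹(Γ)
InKernelφ¹ : ∀ {n} {G : SimpleGraph n} → Aut G → Set
InKernelφ¹ {G = G} g = ∀ (f : Ω¹ G) → pullback g f ≈H¹ f

IsIdentity : ∀ {n} {G : SimpleGraph n} → Aut G → Set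
IsIdentity {n} g = ∀ (v : Fin n) → perm g ⟨$⟩ʳ v ≡ v

-- If g acts trivially on H¹, then for every oriented edge (a, b) the cochain δ a b − δ (g a) (g b)
-- is a coboundary D u: the potential u jumps by +1 across (a, b), by −1 across (g a, g b), and is
-- constant across every other edge.  Since u cannot strictly increase around a cycle, g maps the
-- arcs of every cycle to arcs of the same cycle.  Minimum degree 2 provides non-backtracking walks,
-- which end by re-entering a given set S or by closing a cycle; when S contains x, g x and g⁻¹ x and
-- u is constant on S, both endings contradict the jumps of u along an edge (x, z) moved by g.  With
-- S = {x} this shows that the fixed points of g are closed under adjacency; with S a cycle and
-- (x, z) an edge leaving it, which exists because b₁ ≥ 2 forces a vertex of degree 3, it yields a
-- first fixed point.  Connectivity does the rest.

module Submission where

open import Defs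
open import Data.Nat using (ℕ; _≤_)

open import Data.Bool using (true; false; if_then_else_; _∧_)
import Data.Bool.Properties as BoolP
open import Data.Empty using (⊥; ⊥-elim)
open import Data.Fin as Fin using (Fin; toℕ)
open import Data.Fin.Permutation using (_⟨$⟩ʳ_; _⟨$⟩ˡ_; inverseˡ; inverseʳ)
import Data.Fin.Properties as FinP
open import Data.List using (List; []; _∷_; [_]; length)
open import Data.List.Membership.Propositional using (_∈_)
import Data.List.Relation.Unary.Any as Any
open import Data.Nat as ℕ using (zero; suc; _+_; _*_; _∸_; _<_; _<ᵇ_; z≤n; s≤s)
open import Data.Nat.Induction using (<-wellFounded)
import Data.Nat.Properties as ℕP
open import Algebra.Properties.CommutativeSemigroup ℕP.+-commutativeSemigroup using (interchange)
open import Data.Product using (∃; ∃₂; _×_; _,_; proj₁; proj₂; uncurry; swap; map₂)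
open import Data.Product.Properties using (≡-dec; ,-injective)
open import Data.Rational as ℚ using (ℚ; 0ℚ; 1ℚ; -_; _-_)
import Data.Rational.Properties as ℚP
open import Data.Rational.Solver using (module +-*-Solver)
open import Data.Sum using (_⊎_; inj₁; inj₂)
open import Function using (_∘_; flip; _⇔_; mk⇔; Injective; Equivalence)
open import Induction.WellFounded using (Acc; acc)
open import Relation.Binary using (Rel; Reflexive; Transitive; DecidableEquality; tri<; tri≈; tri>)
open import Relation.Binary.PropositionalEquality as ≡ using (_≡_; _≢_; refl; cong; cong₂; subst; subst₂)
open import Relation.Nullary using (¬_; Dec; yes; no; does; ofʸ; ofⁿ)
open import Relation.Nullary.Decidable using (_⊎-dec_; _×-dec_; ¬?)
open import Relation.Nullary.Negation using (contradiction)
open import Relation.Unary using (Pred; Decidable)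

stepwise⇒monotone : ∀ {a ℓ} {A : Set a} (_∼_ : Rel A ℓ) → Reflexive _∼_ → Transitive _∼_ →
                    (f : ℕ → A) {p q : ℕ} → p ≤ q → (∀ {i} → p ≤ i → i < q → f i ∼ f (suc i)) → f p ∼ f q
stepwise⇒monotone _∼_ refl∼ trans∼ f {q = zero} z≤n steps = refl∼
stepwise⇒monotone _∼_ refl∼ trans∼ f {p} {suc q} p≤1+q steps with ℕP.m≤n⇒m<n∨m≡n p≤1+q
... | inj₂ refl = refl∼
... | inj₁ (s≤s p≤q) = trans∼ (stepwise⇒monotone _∼_ refl∼ trans∼ f p≤q λ p≤i i<q → steps p≤i (ℕP.m<n⇒m<1+n i<q))
                              (steps p≤q (ℕP.n<1+n q))

minimal-witness : ∀ {p} {P : Pred ℕ p} → Decidable P → ∀ {k} → P k → ∃ λ i → P i × (∀ {j} → j < i → ¬ P j)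
minimal-witness {P = P} P? {k} = search k (<-wellFounded k)
  where
  search : ∀ k → Acc _<_ k → P k → ∃ λ i → P i × (∀ {j} → j < i → ¬ P j)
  search k (acc smaller) pk with ℕP.anyUpTo? P? k
  ... | yes (j , j<k , pj) = search j (smaller j<k) pj
  ... | no none            = k , pk , λ j<k pj → none (_ , j<k , pj)

Returns : ∀ {A : Set} → (ℕ → A) → ℕ → Set
Returns w k = ∃ λ j → j < k × w j ≡ w k

sequence-returns : ∀ {n} (w : ℕ → Fin n) → ∃ λ k → Returns w (suc k)
sequence-returns w with FinP.pigeonhole (ℕP.n<1+n _) (w ∘ toℕ)
... | i , Fin.suc j , i<j , w-eq = toℕ j , toℕ i , i<j , w-eq

record FirstStop {A : Set} (w : ℕ → A) (S : A → Set) : Set where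
  field
    K : ℕ
    K>0 : 0 < K
    stops : S (w K) ⊎ Returns w K
    avoids : ∀ {i} → 0 < i → i < K → ¬ S (w i)
    distinct : ∀ {i j} → i < K → j < K → w i ≡ w j → i ≡ j

first-stop : ∀ {n} (w : ℕ → Fin n) {S : Fin n → Set} → Decidable S → FirstStop w S
first-stop w {S} S? = from-minimal (minimal-witness Stops? (inj₂ (proj₂ (sequence-returns w))))
  where
  Stops : ℕ → Set
  Stops k = S (w (suc k)) ⊎ Returns w (suc k)

  Stops? : Decidable Stops
  Stops? k = S? (w (suc k)) ⊎-dec ℕP.anyUpTo? (λ j → w j FinP.≟ w (suc k)) (suc k)

  from-minimal : (∃ λ k → Stops k × (∀ {j} → j < k → ¬ Stops j)) → FirstStop w S
  from-minimal (k , stops , earlier) = record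
    { K = suc k ; K>0 = s≤s z≤n ; stops = stops ; avoids = avoids ; distinct = distinct }
    where
    avoids : ∀ {i} → 0 < i → i < suc k → ¬ S (w i)
    avoids {suc i} _ (s≤s i<k) s = earlier i<k (inj₁ s)

    distinct : ∀ {i j} → i < suc k → j < suc k → w i ≡ w j → i ≡ j
    distinct {i} {j} _ _ w-eq with ℕP.<-cmp i j
    ... | tri≈ _ i≡j _ = i≡j
    distinct {i} {suc j} _ (s≤s j<k) w-eq | tri< i<j _ _ = ⊥-elim (earlier j<k (inj₂ (i , i<j , w-eq)))
    distinct {suc i} {j} (s≤s i<k) _ w-eq | tri> _ _ j<i = ⊥-elim (earlier i<k (inj₂ (j , j<i , ≡.sym w-eq)))

p+[q-p]≡q : ∀ p q → p ℚ.+ (q - p) ≡ q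
p+[q-p]≡q = solve 2 (λ p q → p :+ (q :- p) := q) refl
  where
  open +-*-Solver

0≤q-p⇒p≤q : ∀ {p q} → 0ℚ ℚ.≤ q - p → p ℚ.≤ q
0≤q-p⇒p≤q {p} {q} 0≤q-p = begin
  p             ≡⟨ ℚP.+-identityʳ p ⟨
  p ℚ.+ 0ℚ      ≤⟨ ℚP.+-monoʳ-≤ p 0≤q-p ⟩
  p ℚ.+ (q - p) ≡⟨ p+[q-p]≡q p q ⟩
  q             ∎
  where
  open ℚP.≤-Reasoning

0<q-p⇒p<q : ∀ {p q} → 0ℚ ℚ.< q - p → p ℚ.< q
0<q-p⇒p<q {p} {q} 0<q-p = begin-strict
  p             ≡⟨ ℚP.+-identityʳ p ⟨
  p ℚ.+ 0ℚ      <⟨ ℚP.+-monoʳ-< p 0<q-p ⟩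
  p ℚ.+ (q - p) ≡⟨ p+[q-p]≡q p q ⟩
  q             ∎
  where
  open ℚP.≤-Reasoning

-‿mono-≤ : ∀ {p p′ q q′} → p ℚ.≤ p′ → q′ ℚ.≤ q → p - q ℚ.≤ p′ - q′
-‿mono-≤ p≤p′ q′≤q = ℚP.+-mono-≤ p≤p′ (ℚP.neg-antimono-≤ q′≤q)

indicator : ∀ {p} {P : Set p} → Dec P → ℚ
indicator (yes _) = 1ℚ
indicator (no _)  = 0ℚ

indicator-cong : ∀ {p q} {P : Set p} {Q : Set q} → P ⇔ Q → (P? : Dec P) (Q? : Dec Q) → indicator P? ≡ indicator Q?
indicator-cong P⇔Q (yes _) (yes _) = refl
indicator-cong P⇔Q (no _)  (no _)  = refl
indicator-cong P⇔Q (yes p) (no ¬q) = ⊥-elim (¬q (Equivalence.to P⇔Q p))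
indicator-cong P⇔Q (no ¬p) (yes q) = ⊥-elim (¬p (Equivalence.from P⇔Q q))

module _ {n : ℕ} where
  private
    V = Fin n

  _≟²_ : DecidableEquality (V × V)
  _≟²_ = ≡-dec FinP._≟_ FinP._≟_

  δ : V → V → V → V → ℚ
  δ a b v w = indicator ((v , w) ≟² (a , b)) - indicator ((v , w) ≟² (b , a))

  δ-antisym : ∀ a b v w → δ a b w v ≡ - δ a b v w
  δ-antisym a b v w = begin
    δ a b w v
      ≡⟨ cong₂ _-_ (indicator-cong swap-⇔ ((w , v) ≟² (a , b)) ((v , w) ≟² (b , a)))
                   (indicator-cong swap-⇔ ((w , v) ≟² (b , a)) ((v , w) ≟² (a , b))) ⟩
    indicator ((v , w) ≟² (b , a)) - indicator ((v , w) ≟² (a , b))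
      ≡⟨ solve 2 (λ x y → y :- x := :- (x :- y)) refl (indicator ((v , w) ≟² (a , b))) (indicator ((v , w) ≟² (b , a))) ⟩
    - δ a b v w
      ∎
    where
    open ≡.≡-Reasoning
    open +-*-Solver
    swap-⇔ : ∀ {x y s t : V} → (x , y) ≡ (s , t) ⇔ (y , x) ≡ (t , s)
    swap-⇔ = mk⇔ (cong swap) (cong swap)

  δ-map : ∀ {f : V → V} → Injective _≡_ _≡_ f → ∀ a b v w → δ (f a) (f b) (f v) (f w) ≡ δ a b v w
  δ-map {f} f-inj a b v w = cong₂ _-_ (indicator-cong map-⇔ ((f v , f w) ≟² (f a , f b)) ((v , w) ≟² (a , b)))
                                      (indicator-cong map-⇔ ((f v , f w) ≟² (f b , f a)) ((v , w) ≟² (b , a)))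
    where
    map-⇔ : ∀ {x y s t} → (f x , f y) ≡ (f s , f t) ⇔ (x , y) ≡ (s , t)
    map-⇔ = mk⇔ (λ eq → let x≡s , y≡t = ,-injective eq in cong₂ _,_ (f-inj x≡s) (f-inj y≡t))
                (λ { refl → refl })

  δ-forward : ∀ {a b} → a ≢ b → δ a b a b ≡ 1ℚ
  δ-forward {a} {b} a≢b with (a , b) ≟² (a , b) | (a , b) ≟² (b , a)
  ... | yes _  | no _   = refl
  ... | no ¬eq | _      = ⊥-elim (¬eq refl)
  ... | yes _  | yes eq = ⊥-elim (a≢b (proj₁ (,-injective eq)))

  δ-nonneg : ∀ {a b v w} → (v , w) ≢ (b , a) → 0ℚ ℚ.≤ δ a b v w
  δ-nonneg {a} {b} {v} {w} ≢ba with (v , w) ≟² (a , b) | (v , w) ≟² (b , a)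
  ... | _     | yes eq = ⊥-elim (≢ba eq)
  ... | yes _ | no _   = ℚP.nonNegative⁻¹ 1ℚ
  ... | no _  | no _   = ℚP.≤-refl

  δ-nonpos : ∀ {a b v w} → (v , w) ≢ (a , b) → δ a b v w ℚ.≤ 0ℚ
  δ-nonpos {a} {b} {v} {w} ≢ab with (v , w) ≟² (a , b) | (v , w) ≟² (b , a)
  ... | yes eq | _     = ⊥-elim (≢ab eq)
  ... | no _   | yes _ = ℚP.nonPositive⁻¹ (- 1ℚ)
  ... | no _   | no _  = ℚP.≤-refl

Edge : ∀ {n} → SimpleGraph n → Fin n → Fin n → Set
Edge G v w = Adj G v w ≡ true

edge-sym : ∀ {n} {G : SimpleGraph n} {v w} → Edge G v w → Edge G w v
edge-sym {G = G} {v} {w} e = ≡.trans (SimpleGraph.sym G w v) e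

edge-irrefl : ∀ {n} {G : SimpleGraph n} {v w} → Edge G v w → v ≢ w
edge-irrefl {G = G} {v} e refl with ≡.trans (≡.sym e) (irrefl G v)
... | ()

record Cycle {n} (G : SimpleGraph n) : Set where
  field
    len : ℕ
    c : ℕ → Fin n
    3≤len : 3 ≤ len
    edge : ∀ {i} → i < len → Edge G (c i) (c (suc i))
    closed : c len ≡ c 0
    injective : ∀ {i j} → i < len → j < len → c i ≡ c j → i ≡ j

module _ {n} {G : SimpleGraph n} (C : Cycle G) where
  open Cycle C
  private
    V = Fin n

  OnCycle : V → Set
  OnCycle v = ∃ λ i → i < len × c i ≡ v

  Arc : V → V → Set
  Arc v w = ∃ λ i → i < len × c i ≡ v × c (suc i) ≡ w

  on-cycle? : Decidable OnCycle
  on-cycle? v = ℕP.anyUpTo? (λ i → c i FinP.≟ v) len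

  arc? : ∀ v w → Dec (Arc v w)
  arc? v w = ℕP.anyUpTo? (λ i → (c i FinP.≟ v) ×-dec (c (suc i) FinP.≟ w)) len

  private
    0<len : 0 < len
    0<len = ℕP.<-≤-trans (s≤s z≤n) 3≤len

    len≢2 : len ≢ 2
    len≢2 refl with 3≤len
    ... | s≤s (s≤s ())

    wraps : ∀ {i} → suc i ≡ len → c (suc i) ≡ c 0
    wraps 1+i≡len = ≡.trans (cong c 1+i≡len) closed

  step-arc : ∀ {i} → i < len → Arc (c i) (c (suc i))
  step-arc {i} i<len = i , i<len , refl , refl

  arc-along : ∀ {i v w} → i < len → (c i , c (suc i)) ≡ (v , w) → Arc v w
  arc-along i<len eq = subst (uncurry Arc) eq (step-arc i<len)

  start-on-cycle : OnCycle (c 0)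
  start-on-cycle = 0 , 0<len , refl

  arc-edge : ∀ {v w} → Arc v w → Edge G v w
  arc-edge (i , i<len , refl , refl) = edge i<len

  Exit : V → V → Set
  Exit v w = Edge G v w × ¬ Arc v w × ¬ Arc w v

  arc-source : ∀ {v w} → Arc v w → OnCycle v
  arc-source (i , i<len , ci≡v , _) = i , i<len , ci≡v

  arc-target : ∀ {v w} → Arc v w → OnCycle w
  arc-target (i , i<len , _ , refl) with ℕP.m≤n⇒m<n∨m≡n i<len
  ... | inj₁ 1+i<len = suc i , 1+i<len , refl
  ... | inj₂ 1+i≡len = 0 , 0<len , ≡.sym (wraps 1+i≡len)

  arc-from : ∀ {v} → OnCycle v → ∃ (Arc v)
  arc-from (i , i<len , ci≡v) = c (suc i) , i , i<len , ci≡v , refl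

  arc-into : ∀ {v} → OnCycle v → ∃ λ u → Arc u v
  arc-into (suc i , 1+i<len , refl) = c i , i , ℕP.<-trans (ℕP.n<1+n i) 1+i<len , refl , refl
  arc-into (zero , _ , refl) = c l , l , subst (l <_) 1+l≡len (ℕP.n<1+n l) , refl , wraps 1+l≡len
    where
    l = ℕ.pred len
    1+l≡len : suc l ≡ len
    1+l≡len = ℕP.suc-pred len {{ℕ.>-nonZero 0<len}}

  private
    successor-injective : ∀ {i j} → i < len → j < len → c (suc i) ≡ c (suc j) → i ≡ j
    successor-injective {i} {j} i<len j<len eq with ℕP.m≤n⇒m<n∨m≡n i<len | ℕP.m≤n⇒m<n∨m≡n j<len
    ... | inj₁ 1+i<len | inj₁ 1+j<len = ℕP.suc-injective (injective 1+i<len 1+j<len eq)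
    ... | inj₂ 1+i≡len | inj₂ 1+j≡len = ℕP.suc-injective (≡.trans 1+i≡len (≡.sym 1+j≡len))
    ... | inj₁ 1+i<len | inj₂ 1+j≡len with injective 1+i<len 0<len (≡.trans eq (wraps 1+j≡len))
    ... | ()
    successor-injective i<len j<len eq | inj₂ 1+i≡len | inj₁ 1+j<len
      with injective 1+j<len 0<len (≡.trans (≡.sym eq) (wraps 1+i≡len))
    ... | ()

  arc-functional : ∀ {v w w′} → Arc v w → Arc v w′ → w ≡ w′
  arc-functional (i , i<len , refl , refl) (j , j<len , cj≡ci , refl) with injective j<len i<len cj≡ci
  ... | refl = refl

  arc-injective : ∀ {v v′ w} → Arc v w → Arc v′ w → v ≡ v′
  arc-injective (i , i<len , refl , ci+1≡w) (j , j<len , refl , cj+1≡w)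
    with successor-injective i<len j<len (≡.trans ci+1≡w (≡.sym cj+1≡w))
  ... | refl = refl

  arc-asym : ∀ {v w} → Arc v w → ¬ Arc w v
  arc-asym (i , i<len , refl , refl) (s , s<len , cs≡ci+1 , cs+1≡ci) with ℕP.m≤n⇒m<n∨m≡n i<len
  ... | inj₂ 1+i≡len with injective s<len 0<len (≡.trans cs≡ci+1 (wraps 1+i≡len))
  ...   | refl with injective (ℕP.<-≤-trans (s≤s (s≤s z≤n)) 3≤len) i<len cs+1≡ci
  ...     | refl = len≢2 (≡.sym 1+i≡len)
  arc-asym (i , i<len , refl , refl) (s , s<len , cs≡ci+1 , cs+1≡ci) | inj₁ 1+i<len
    with injective s<len 1+i<len cs≡ci+1
  ... | refl with ℕP.m≤n⇒m<n∨m≡n 1+i<len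
  ...   | inj₁ 2+i<len = ℕP.<-irrefl (≡.sym (injective 2+i<len i<len cs+1≡ci)) (ℕP.<-trans (ℕP.n<1+n i) (ℕP.n<1+n (suc i)))
  ...   | inj₂ 2+i≡len with injective 0<len i<len (≡.trans (≡.sym (wraps 2+i≡len)) cs+1≡ci)
  ...     | refl = len≢2 (≡.sym 2+i≡len)

  no-ascent : (f : V → ℚ) → (∀ {i} → i < len → f (c i) ℚ.≤ f (c (suc i))) → ∀ {v w} → Arc v w → ¬ f v ℚ.< f w
  no-ascent f ascending (s , s<len , refl , refl) ascent = ℚP.<-irrefl (cong f (≡.sym closed)) (begin-strict
    f (c 0)       ≤⟨ along z≤n (ℕP.<⇒≤ s<len) ⟩
    f (c s)       <⟨ ascent ⟩
    f (c (suc s)) ≤⟨ along s<len ℕP.≤-refl ⟩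
    f (c len)     ∎)
    where
    open ℚP.≤-Reasoning
    along : ∀ {p q} → p ≤ q → q ≤ len → f (c p) ℚ.≤ f (c q)
    along p≤q q≤len = stepwise⇒monotone ℚ._≤_ ℚP.≤-refl ℚP.≤-trans (f ∘ c) p≤q
                        (λ _ i<q → ascending (ℕP.<-≤-trans i<q q≤len))

module Trail {n} {G : SimpleGraph n} (w : ℕ → Fin n)
             (edge : ∀ i → Edge G (w i) (w (suc i)))
             (nonbacktracking : ∀ i → w (suc (suc i)) ≢ w i) where

  module _ {S} (stop : FirstStop w S) {j} (j<K : j < FirstStop.K stop) (return : w j ≡ w (FirstStop.K stop)) where
    open FirstStop stop

    private
      d = K ∸ j
      d+j≡K : d + j ≡ K
      d+j≡K = ℕP.m∸n+n≡m (ℕP.<⇒≤ j<K)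
      below : ∀ {t} → t < d → t + j < K
      below t<d = subst (_ + j <_) d+j≡K (ℕP.+-monoˡ-< j t<d)
      3≤length : ∀ e → 0 < e → w (e + j) ≡ w j → 3 ≤ e
      3≤length 1 _ eq = ⊥-elim (edge-irrefl {G = G} (edge j) (≡.sym eq))
      3≤length 2 _ eq = ⊥-elim (nonbacktracking j eq)
      3≤length (suc (suc (suc _))) _ _ = s≤s (s≤s (s≤s z≤n))

    returning-cycle : Cycle G
    returning-cycle = record
      { len = d
      ; c = λ t → w (t + j)
      ; 3≤len = 3≤length d (ℕP.m<n⇒0<n∸m j<K) closed
      ; edge = λ {t} _ → edge (t + j)
      ; closed = closed
      ; injective = λ s<d t<d eq → ℕP.+-cancelʳ-≡ _ _ _ (distinct (below s<d) (below t<d) eq)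
      }
      where
      closed : w (d + j) ≡ w j
      closed = ≡.trans (cong w d+j≡K) (≡.sym return)

    on-returning-cycle : ∀ {v} → OnCycle returning-cycle v → ∃ λ t → j ≤ t × t < K × w t ≡ v
    on-returning-cycle (t , t<d , eq) = t + j , ℕP.m≤n+m j t , below t<d , eq

module NonBacktracking {n} {G : SimpleGraph n} (avoid : ∀ p v → ∃ λ w → Edge G v w × w ≢ p) where

  walk : Fin n → Fin n → ℕ → Fin n
  walk p v zero    = p
  walk p v (suc i) = walk v (proj₁ (avoid p v)) i

  walk-edge : ∀ {p v} → Edge G p v → ∀ i → Edge G (walk p v i) (walk p v (suc i))
  walk-edge pv zero = pv
  walk-edge {p} {v} _ (suc i) = walk-edge (proj₁ (proj₂ (avoid p v))) i

  walk-nonbacktracking : ∀ p v i → walk p v (suc (suc i)) ≢ walk p v i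
  walk-nonbacktracking p v zero    = proj₂ (proj₂ (avoid p v))
  walk-nonbacktracking p v (suc i) = walk-nonbacktracking v (proj₁ (avoid p v)) i

  module _ {p v} (pv : Edge G p v) where
    open Trail {G = G} (walk p v) (walk-edge pv) (walk-nonbacktracking p v) public

  some-cycle : Fin n → Cycle G
  some-cycle p = cycle-at (first-stop (walk p v) (λ _ → no λ ()))
    where
    v = proj₁ (avoid p p)
    pv = proj₁ (proj₂ (avoid p p))

    cycle-at : FirstStop (walk p v) (λ _ → ⊥) → Cycle G
    cycle-at stop with FirstStop.stops stop
    ... | inj₁ ()
    ... | inj₂ (j , j<K , return) = returning-cycle pv stop j<K return

sumFin-cong : ∀ {n} {f h : Fin n → ℕ} → (∀ i → f i ≡ h i) → sumFin f ≡ sumFin h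
sumFin-cong {zero}  eq = refl
sumFin-cong {suc n} eq = cong₂ _+_ (eq Fin.zero) (sumFin-cong (eq ∘ Fin.suc))

sumFin-mono : ∀ {n} {f h : Fin n → ℕ} → (∀ i → f i ≤ h i) → sumFin f ≤ sumFin h
sumFin-mono {zero}  le = z≤n
sumFin-mono {suc n} le = ℕP.+-mono-≤ (le Fin.zero) (sumFin-mono (le ∘ Fin.suc))

sumFin-const : ∀ n k → sumFin {n} (λ _ → k) ≡ n * k
sumFin-const zero    k = refl
sumFin-const (suc n) k = cong (k +_) (sumFin-const n k)

sumFin-zero : ∀ n → sumFin {n} (λ _ → 0) ≡ 0
sumFin-zero n = ≡.trans (sumFin-const n 0) (ℕP.*-zeroʳ n)

sumFin-+ : ∀ {n} (f h : Fin n → ℕ) → sumFin (λ i → f i + h i) ≡ sumFin f + sumFin h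
sumFin-+ {zero}  f h = refl
sumFin-+ {suc n} f h = ≡.trans (cong (f Fin.zero + h Fin.zero +_) (sumFin-+ (f ∘ Fin.suc) (h ∘ Fin.suc)))
                               (interchange (f Fin.zero) (h Fin.zero) _ _)

sumFin-swap : ∀ {m n} (f : Fin m → Fin n → ℕ) → sumFin (λ i → sumFin (f i)) ≡ sumFin (λ j → sumFin (λ i → f i j))
sumFin-swap {zero}  {n} f = ≡.sym (sumFin-zero n)
sumFin-swap {suc m} f = ≡.trans (cong (sumFin (f Fin.zero) +_) (sumFin-swap (f ∘ Fin.suc)))
                                (≡.sym (sumFin-+ (f Fin.zero) _))

indicatorℕ : ∀ {p} {P : Set p} → Dec P → ℕ
indicatorℕ P? = if does P? then 1 else 0

sumFin-point : ∀ {n} (p : Fin n) → sumFin (λ w → indicatorℕ (w FinP.≟ p)) ≡ 1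
sumFin-point {suc n} Fin.zero    = cong suc (sumFin-zero n)
sumFin-point {suc n} (Fin.suc p) = sumFin-point p

multiplicity : ∀ {n} → List (Fin n) → Fin n → ℕ
multiplicity []       w = 0
multiplicity (p ∷ ps) w = indicatorℕ (w FinP.≟ p) + multiplicity ps w

sumFin-multiplicity : ∀ {n} (ps : List (Fin n)) → sumFin (multiplicity ps) ≡ length ps
sumFin-multiplicity {n} []   = sumFin-zero n
sumFin-multiplicity (p ∷ ps) =
  ≡.trans (sumFin-+ (λ w → indicatorℕ (w FinP.≟ p)) (multiplicity ps)) (cong₂ _+_ (sumFin-point p) (sumFin-multiplicity ps))

∈⇒multiplicity>0 : ∀ {n} {w : Fin n} {ps} → w ∈ ps → 0 < multiplicity ps w
∈⇒multiplicity>0 {w = w} (Any.here refl) with w FinP.≟ w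
... | yes _ = s≤s z≤n
... | no w≢w = ⊥-elim (w≢w refl)
∈⇒multiplicity>0 {ps = p ∷ _} (Any.there w∈ps) = ℕP.<-≤-trans (∈⇒multiplicity>0 w∈ps) (ℕP.m≤n+m _ _)

module _ {n} (G : SimpleGraph n) where
  private
    V = Fin n

  degree-≤-length : ∀ {v} (ps : List V) → (∀ {w} → Edge G v w → w ∈ ps) → degree G v ≤ length ps
  degree-≤-length {v} ps neighbours = ℕP.≤-trans (sumFin-mono bound) (ℕP.≤-reflexive (sumFin-multiplicity ps))
    where
    bound : ∀ w → (if Adj G v w then 1 else 0) ≤ multiplicity ps w
    bound w with Adj G v w in adj
    ... | true  = ∈⇒multiplicity>0 (neighbours adj)
    ... | false = z≤n

  neighbour-avoiding : ∀ {v} → 2 ≤ degree G v → ∀ p → ∃ λ w → Edge G v w × w ≢ p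
  neighbour-avoiding {v} 2≤deg p with FinP.any? (λ w → (Adj G v w BoolP.≟ true) ×-dec ¬? (w FinP.≟ p))
  ... | yes found = found
  ... | no none   = contradiction 2≤deg (ℕP.≤⇒≯ (degree-≤-length [ p ] only-p))
    where
    only-p : ∀ {w} → Edge G v w → w ∈ [ p ]
    only-p {w} e with w FinP.≟ p
    ... | yes w≡p = Any.here w≡p
    ... | no w≢p  = ⊥-elim (none (w , e , w≢p))

  exit-at-branch : (C : Cycle G) → ∀ {y} → OnCycle C y → 3 ≤ degree G y → ∃ (Exit C y)
  exit-at-branch C {y} y∈C 3≤deg
    with FinP.any? (λ z → (Adj G y z BoolP.≟ true) ×-dec ¬? (arc? C y z) ×-dec ¬? (arc? C z y))
  ... | yes found = found
  ... | no none   = contradiction 3≤deg (ℕP.≤⇒≯ (degree-≤-length (next ∷ previous ∷ []) cycle-neighbour))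
    where
    next = proj₁ (arc-from C y∈C)
    previous = proj₁ (arc-into C y∈C)
    cycle-neighbour : ∀ {z} → Edge G y z → z ∈ next ∷ previous ∷ []
    cycle-neighbour {z} e with arc? C y z | arc? C z y
    ... | yes y→z | _      = Any.here (arc-functional C y→z (proj₂ (arc-from C y∈C)))
    ... | no _    | yes z→y = Any.there (Any.here (arc-injective C z→y (proj₂ (arc-into C y∈C))))
    ... | no ¬y→z | no ¬z→y = ⊥-elim (none (z , e , ¬y→z , ¬z→y))

  cycle-exit : (C : Cycle G) → ∀ {v y} → OnCycle C v → Walk G v y → 3 ≤ degree G y → ∃₂ λ x z → OnCycle C x × Exit C x z
  cycle-exit C v∈C here 3≤deg = _ , _ , v∈C , proj₂ (exit-at-branch C v∈C 3≤deg)
  cycle-exit C {v} v∈C (step {u = v′} e rest) 3≤deg with arc? C v v′ | arc? C v′ v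
  ... | yes v→v′ | _        = cycle-exit C (arc-target C v→v′) rest 3≤deg
  ... | no _     | yes v′→v = cycle-exit C (arc-source C v′→v) rest 3≤deg
  ... | no ¬v→v′ | no ¬v′→v = v , v′ , v∈C , e , ¬v→v′ , ¬v′→v

  private
    forward : V → V → ℕ
    forward v w = if (toℕ v <ᵇ toℕ w) ∧ Adj G v w then 1 else 0

    exactly-one-order : ∀ {v w} → Edge G v w → (if toℕ v <ᵇ toℕ w then 1 else 0) + (if toℕ w <ᵇ toℕ v then 1 else 0) ≡ 1
    exactly-one-order {v} {w} e
      with toℕ v <ᵇ toℕ w | ℕP.<ᵇ-reflects-< (toℕ v) (toℕ w) | toℕ w <ᵇ toℕ v | ℕP.<ᵇ-reflects-< (toℕ w) (toℕ v)
    ... | true  | ofʸ v<w | true  | ofʸ w<v = ⊥-elim (ℕP.<-asym v<w w<v)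
    ... | true  | _       | false | _       = refl
    ... | false | _       | true  | _       = refl
    ... | false | ofⁿ v≮w | false | ofⁿ w≮v =
      ⊥-elim (edge-irrefl {G = G} e (FinP.toℕ-injective (ℕP.≤-antisym (ℕP.≮⇒≥ w≮v) (ℕP.≮⇒≥ v≮w))))

    forward-pair : ∀ v w → forward v w + forward w v ≡ (if Adj G v w then 1 else 0)
    forward-pair v w rewrite SimpleGraph.sym G w v with Adj G v w in adj
    ... | false rewrite BoolP.∧-zeroʳ (toℕ v <ᵇ toℕ w) | BoolP.∧-zeroʳ (toℕ w <ᵇ toℕ v) = refl
    ... | true rewrite BoolP.∧-identityʳ (toℕ v <ᵇ toℕ w) | BoolP.∧-identityʳ (toℕ w <ᵇ toℕ v) = exactly-one-order adj

  handshake : numEdges G + numEdges G ≡ sumFin (degree G)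
  handshake = begin
    numEdges G + numEdges G
      ≡⟨ cong (numEdges G +_) (sumFin-swap forward) ⟩
    sumFin (λ v → sumFin (forward v)) + sumFin (λ v → sumFin (λ w → forward w v))
      ≡⟨ sumFin-+ (λ v → sumFin (forward v)) (λ v → sumFin (λ w → forward w v)) ⟨
    sumFin (λ v → sumFin (forward v) + sumFin (λ w → forward w v))
      ≡⟨ sumFin-cong (λ v → sumFin-+ (forward v) (λ w → forward w v)) ⟨
    sumFin (λ v → sumFin (λ w → forward v w + forward w v))
      ≡⟨ sumFin-cong (λ v → sumFin-cong (forward-pair v)) ⟩
    sumFin (degree G)
      ∎
    where
    open ≡.≡-Reasoning

  branch-vertex : 2 ≤ betti1 G → ∃ λ y → 3 ≤ degree G y
  branch-vertex 2≤b₁ with FinP.all? (λ y → degree G y ℕ.≤? 2)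
  ... | no ¬all = map₂ ℕP.≰⇒> (FinP.¬∀⟶∃¬ n _ (λ y → degree G y ℕ.≤? 2) ¬all)
  ... | yes all = contradiction 2≤b₁ (ℕP.≤⇒≯ b₁≤1)
    where
    2E≤2n : numEdges G + numEdges G ≤ n + n
    2E≤2n = begin
      numEdges G + numEdges G ≡⟨ handshake ⟩
      sumFin (degree G)       ≤⟨ sumFin-mono all ⟩
      sumFin {n} (λ _ → 2)    ≡⟨ sumFin-const n 2 ⟩
      n * 2                   ≡⟨ ℕP.*-comm n 2 ⟩
      n + (n + 0)             ≡⟨ cong (n +_) (ℕP.+-identityʳ n) ⟩
      n + n                   ∎
      where
      open ℕP.≤-Reasoning
    E≤n : numEdges G ≤ n
    E≤n = ℕP.≮⇒≥ λ n<E → ℕP.<⇒≱ (ℕP.+-mono-< n<E n<E) 2E≤2n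
    b₁≤1 : betti1 G ≤ 1
    b₁≤1 = ℕP.≤-trans (ℕP.∸-monoˡ-≤ n (ℕP.+-monoˡ-≤ 1 E≤n)) (ℕP.≤-reflexive (ℕP.m+n∸m≡n n 1))

module Kernel {n} {G : SimpleGraph n} (g : Aut G) (ker : InKernelφ¹ g) where
  private
    V = Fin n

  γ : V → V
  γ v = perm g ⟨$⟩ʳ v

  γ⁻¹ : V → V
  γ⁻¹ v = perm g ⟨$⟩ˡ v

  γ-γ⁻¹ : ∀ v → γ (γ⁻¹ v) ≡ v
  γ-γ⁻¹ v = inverseʳ (perm g)

  γ⁻¹-γ : ∀ v → γ⁻¹ (γ v) ≡ v
  γ⁻¹-γ v = inverseˡ (perm g)

  γ-injective : Injective _≡_ _≡_ γ
  γ-injective {v} {w} eq = ≡.trans (≡.sym (γ⁻¹-γ v)) (≡.trans (cong γ⁻¹ eq) (γ⁻¹-γ w))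

  γ-transpose : ∀ {v x} → γ v ≡ x → v ≡ γ⁻¹ x
  γ-transpose {v} refl = ≡.sym (γ⁻¹-γ v)

  γ-pair-injective : ∀ {v w v′ w′} → (γ v , γ w) ≡ (γ v′ , γ w′) → (v , w) ≡ (v′ , w′)
  γ-pair-injective eq = let v≡v′ , w≡w′ = ,-injective eq in cong₂ _,_ (γ-injective v≡v′) (γ-injective w≡w′)

  γ-edge : ∀ {v w} → Edge G v w → Edge G (γ v) (γ w)
  γ-edge {v} {w} e = ≡.trans (preserves g v w) e

  γ-edge⁻¹ : ∀ {v w} → Edge G (γ v) (γ w) → Edge G v w
  γ-edge⁻¹ {v} {w} e = ≡.trans (≡.sym (preserves g v w)) e

  elementary : V → V → Ω¹ G
  elementary a b = record { val = δ a b ; antisym = λ v w _ → δ-antisym a b w v }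

  -- The kernel hypothesis applied to δ (γ a) (γ b), whose pullback is δ a b.
  potential : V → V → V → ℚ
  potential a b = proj₁ (ker (elementary (γ a) (γ b)))

  potential-step : ∀ a b {v w} → Edge G v w → potential a b w - potential a b v ≡ δ a b v w - δ (γ a) (γ b) v w
  potential-step a b {v} {w} e =
    ≡.trans (≡.sym (proj₂ (ker (elementary (γ a) (γ b))) v w e)) (cong (_- δ (γ a) (γ b) v w) (δ-map γ-injective a b v w))

  module Potential (a b : V) where
    u : V → ℚ
    u = potential a b

    ascends : ∀ {v w} → Edge G v w → (v , w) ≢ (b , a) → (v , w) ≢ (γ a , γ b) → u v ℚ.≤ u w
    ascends e ≢ba ≢γab =
      0≤q-p⇒p≤q (subst (0ℚ ℚ.≤_) (≡.sym (potential-step a b e)) (-‿mono-≤ (δ-nonneg ≢ba) (δ-nonpos ≢γab)))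

    descends : ∀ {v w} → Edge G v w → (v , w) ≢ (a , b) → (v , w) ≢ (γ b , γ a) → u w ℚ.≤ u v
    descends e ≢ab ≢γba = ascends (edge-sym {G = G} e) (≢ab ∘ cong swap) (≢γba ∘ cong swap)

    rises-along : Edge G a b → (γ a , γ b) ≢ (a , b) → u a ℚ.< u b
    rises-along e moved = 0<q-p⇒p<q (begin-strict
      0ℚ                             <⟨ ℚP.positive⁻¹ 1ℚ ⟩
      1ℚ - 0ℚ                        ≤⟨ -‿mono-≤ ℚP.≤-refl (δ-nonpos (moved ∘ ≡.sym)) ⟩
      1ℚ - δ (γ a) (γ b) a b         ≡⟨ cong (_- δ (γ a) (γ b) a b) (δ-forward (edge-irrefl {G = G} e)) ⟨
      δ a b a b - δ (γ a) (γ b) a b  ≡⟨ potential-step a b e ⟨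
      u b - u a                      ∎)
      where
      open ℚP.≤-Reasoning

    falls-along-image : Edge G a b → (γ a , γ b) ≢ (a , b) → u (γ b) ℚ.< u (γ a)
    falls-along-image e moved = 0<q-p⇒p<q (begin-strict
      0ℚ                                              <⟨ ℚP.positive⁻¹ 1ℚ ⟩
      0ℚ - - 1ℚ                                       ≤⟨ -‿mono-≤ (δ-nonneg (moved ∘ cong swap)) (ℚP.≤-refl { - 1ℚ}) ⟩
      δ a b (γ b) (γ a) - - 1ℚ                        ≡⟨ cong (λ d → δ a b (γ b) (γ a) - d) backward ⟨
      δ a b (γ b) (γ a) - δ (γ a) (γ b) (γ b) (γ a)  ≡⟨ potential-step a b (γ-edge (edge-sym {G = G} e)) ⟨
      u (γ a) - u (γ b)                               ∎)
      where
      open ℚP.≤-Reasoning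
      backward : δ (γ a) (γ b) (γ b) (γ a) ≡ - 1ℚ
      backward = ≡.trans (δ-antisym (γ a) (γ b) (γ a) (γ b)) (cong -_ (δ-forward (edge-irrefl {G = G} (γ-edge e))))

  module _ (C : Cycle G) where
    open Cycle C

    arc-image : ∀ {a b} → Arc C a b → Arc C (γ a) (γ b)
    arc-image {a} {b} a→b with arc? C (γ a) (γ b)
    ... | yes γa→γb = γa→γb
    ... | no ¬γa→γb = ⊥-elim (no-ascent C u ascending a→b (rises-along (arc-edge C a→b) moved))
      where
      open Potential a b
      moved : (γ a , γ b) ≢ (a , b)
      moved eq = ¬γa→γb (subst (uncurry (Arc C)) (≡.sym eq) a→b)
      ascending : ∀ {i} → i < len → u (c i) ℚ.≤ u (c (suc i))
      ascending i<len = ascends (edge i<len) (arc-asym C a→b ∘ arc-along C i<len) (¬γa→γb ∘ arc-along C i<len)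

    arc-reflect : ∀ {a b} → Arc C (γ a) (γ b) → Arc C a b
    arc-reflect {a} {b} γa→γb with arc? C a b
    ... | yes a→b = a→b
    ... | no ¬a→b =
      ⊥-elim (no-ascent C (-_ ∘ u) ascending γa→γb (ℚP.neg-antimono-< (falls-along-image (γ-edge⁻¹ (arc-edge C γa→γb)) moved)))
      where
      open Potential a b
      moved : (γ a , γ b) ≢ (a , b)
      moved eq = ¬a→b (subst (uncurry (Arc C)) eq γa→γb)
      ascending : ∀ {i} → i < len → - u (c i) ℚ.≤ - u (c (suc i))
      ascending i<len =
        ℚP.neg-antimono-≤ (descends (edge i<len) (¬a→b ∘ arc-along C i<len) (arc-asym C γa→γb ∘ arc-along C i<len))

    image-on-cycle : ∀ {v} → OnCycle C v → OnCycle C (γ v)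
    image-on-cycle v∈C = arc-source C (arc-image (proj₂ (arc-from C v∈C)))

    preimage-on-cycle : ∀ {v} → OnCycle C v → OnCycle C (γ⁻¹ v)
    preimage-on-cycle {v} v∈C =
      arc-source C (arc-reflect (subst₂ (Arc C) (≡.sym (γ-γ⁻¹ v)) (≡.sym (γ-γ⁻¹ _)) (proj₂ (arc-from C v∈C))))

  module _ (avoid : ∀ p v → ∃ λ w → Edge G v w × w ≢ p) where
    open NonBacktracking {G = G} avoid

    -- If γ moved the edge (x, z), then u x < u z and u (γ z) < u (γ x) = u x.  Follow the
    -- non-backtracking walk x, z, … until it re-enters S or closes a cycle D: re-entering S
    -- forces u z ≤ u x, while closing D forces u z ≤ u (γ z), because γ maps D into itself.
    module Escape {x z} (xz : Edge G x z)
                  {S : V → Set} (S? : Decidable S) (x∈S : S x) (γx∈S : S (γ x)) (γ⁻¹x∈S : S (γ⁻¹ x))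
                  (level : ∀ {v} → S v → potential x z v ≡ potential x z x) where
      open Potential x z

      private
        w : ℕ → V
        w = walk x z

      module _ (stop : FirstStop w S) where
        open FirstStop stop

        private
          no-return-step : ∀ {i} → 0 < i → i < K → (w i , w (suc i)) ≢ (z , x)
          no-return-step {1} _ _ eq = walk-nonbacktracking x z 0 (proj₂ (,-injective eq))
          no-return-step {suc (suc i)} _ 2+i<K eq
            with distinct 2+i<K (ℕP.<-trans (s≤s (s≤s z≤n)) 2+i<K) (proj₁ (,-injective eq))
          ... | ()

          rising : ∀ {k} → 0 < k → k ≤ K → u z ℚ.≤ u (w k)
          rising 0<k k≤K = stepwise⇒monotone ℚ._≤_ ℚP.≤-refl ℚP.≤-trans (u ∘ w) 0<k λ {i} 0<i i<k →
            let i<K = ℕP.<-≤-trans i<k k≤K in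
            ascends (walk-edge xz i) (no-return-step 0<i i<K)
                    (λ eq → avoids 0<i i<K (subst S (≡.sym (proj₁ (,-injective eq))) γx∈S))

          falling : ∀ {k} → 0 < k → k < K → u (γ (w k)) ℚ.≤ u (γ z)
          falling 0<k k<K =
            stepwise⇒monotone (flip ℚ._≤_) ℚP.≤-refl (flip ℚP.≤-trans) (u ∘ γ ∘ w) 0<k λ {i} 0<i i<k →
            let i<K = ℕP.<-trans i<k k<K in
            descends (γ-edge (walk-edge xz i))
                     (λ eq → avoids 0<i i<K (subst S (≡.sym (γ-transpose (proj₁ (,-injective eq)))) γ⁻¹x∈S))
                     (no-return-step 0<i i<K ∘ γ-pair-injective)

        not-moved : ¬ (γ x , γ z) ≢ (x , z)
        not-moved moved with S? (w K) | stops
        ... | yes hit | _ = ℚP.<-irrefl refl (begin-strict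
          u x      <⟨ rises-along xz moved ⟩
          u z      ≤⟨ rising K>0 ℕP.≤-refl ⟩
          u (w K)  ≡⟨ level hit ⟩
          u x      ∎)
          where
          open ℚP.≤-Reasoning
        ... | no miss | inj₁ hit = miss hit
        ... | no miss | inj₂ (zero , _ , return) = miss (subst S return x∈S)
        ... | no miss | inj₂ (suc j , j<K , return) =
          image-on-walk (on-returning-cycle xz stop j<K return (image-on-cycle cycle (start-on-cycle cycle)))
          where
          cycle : Cycle G
          cycle = returning-cycle xz stop j<K return

          image-on-walk : ¬ ∃ λ t → suc j ≤ t × t < K × w t ≡ γ (w (suc j))
          image-on-walk (t , j<t , t<K , wt≡γwj) = ℚP.<-irrefl refl (begin-strict
            u z                 ≤⟨ rising (ℕP.<-≤-trans (s≤s z≤n) j<t) (ℕP.<⇒≤ t<K) ⟩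
            u (w t)             ≡⟨ cong u wt≡γwj ⟩
            u (γ (w (suc j)))   ≤⟨ falling (s≤s z≤n) j<K ⟩
            u (γ z)             <⟨ falls-along-image xz moved ⟩
            u (γ x)             ≡⟨ level γx∈S ⟩
            u x                 <⟨ rises-along xz moved ⟩
            u z                 ∎)
            where
            open ℚP.≤-Reasoning hiding (stop)

      edge-fixed : (γ x , γ z) ≡ (x , z)
      edge-fixed with (γ x , γ z) ≟² (x , z)
      ... | yes fixed = fixed
      ... | no moved  = ⊥-elim (not-moved (first-stop w S?) moved)

    fixed-neighbour : ∀ {x a} → γ x ≡ x → Edge G x a → γ a ≡ a
    fixed-neighbour {x} γx≡x xa =
      proj₂ (,-injective (Escape.edge-fixed xa (FinP._≟ x) refl γx≡x γ⁻¹x≡x λ { refl → refl }))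
      where
      γ⁻¹x≡x : γ⁻¹ x ≡ x
      γ⁻¹x≡x = ≡.trans (cong γ⁻¹ (≡.sym γx≡x)) (γ⁻¹-γ x)

    fixed-walk : ∀ {x y} → γ x ≡ x → Walk G x y → γ y ≡ y
    fixed-walk γx≡x here          = γx≡x
    fixed-walk γx≡x (step e rest) = fixed-walk (fixed-neighbour γx≡x e) rest

    exit-fixed : (C : Cycle G) → ∀ {x z} → OnCycle C x → Exit C x z → γ x ≡ x
    exit-fixed C {x} {z} x∈C@(r , r<len , refl) (xz , ¬x→z , ¬z→x) =
      proj₁ (,-injective (Escape.edge-fixed xz (on-cycle? C) x∈C (image-on-cycle C x∈C) (preimage-on-cycle C x∈C) level))
      where
      open Cycle C
      open Potential x z
      flat : ∀ {i} → i < len → u (c i) ≡ u (c (suc i))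
      flat i<len = ℚP.≤-antisym
        (ascends (edge i<len) (¬z→x ∘ arc-along C i<len) (¬x→z ∘ arc-reflect C ∘ arc-along C i<len))
        (descends (edge i<len) (¬x→z ∘ arc-along C i<len) (¬z→x ∘ arc-reflect C ∘ arc-along C i<len))
      level-from-start : ∀ {i} → i < len → u (c i) ≡ u (c 0)
      level-from-start i<len = ≡.sym (stepwise⇒monotone _≡_ refl ≡.trans (u ∘ c) z≤n λ _ k<i → flat (ℕP.<-trans k<i i<len))
      level : ∀ {v} → OnCycle C v → u v ≡ u x
      level (i , i<len , refl) = ≡.trans (level-from-start i<len) (≡.sym (level-from-start r<len))

theorem3p12 : ∀ (n : ℕ) (G : SimpleGraph n) → Connected G
    → (∀ v → 2 ≤ degree G v) → 2 ≤ betti1 G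
    → ∀ (g : Aut G) → InKernelφ¹ g → IsIdentity g
theorem3p12 n G connected 2≤deg 2≤b₁ g ker v =
  let y , 3≤deg          = branch-vertex G 2≤b₁
      x , _ , x∈C , exit = cycle-exit G C (start-on-cycle C) (connected (Cycle.c C 0) y) 3≤deg
  in fixed-walk avoid (exit-fixed avoid C x∈C exit) (connected x v)
  where
  open Kernel g ker

  avoid : ∀ p v → ∃ λ w → Edge G v w × w ≢ p
  avoid p v = neighbour-avoiding G (2≤deg v) p

  C : Cycle G
  C = NonBacktracking.some-cycle avoid v
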